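{- Let $G$ be a simple undirected graph. Then $\zeta^*(G)=1$ if and only if $G$ has at most one edge.
   Context: The centroidal localization game on a simple undirected graph $G=(V,E)$ with parameter $k\ge 1$ is played as follows. First the Robber-player secretly places the robber at a vertex $r$. Then, at every turn, the Cop-player probes a set $\{v_1,\dots,v_k\}$ of (at most) $k$ vertices; in return she learns, for each probed $v_i$, whether $d(v_i,r)=0$, and, for every $1\le i<j\le k$, whether $d(v_i,r)<d(v_j,r)$, $d(v_i,r)=d(v_j,r)$ or $d(v_i,r)>d(v_j,r)$ (here $d$ is the graph distance, which is infinite between vertices of different connected components). If this information (together with all previous information) uniquely determines the current position of the robber, the Cop-player wins. Otherwise the robber may move along one edge (or stay), and the next turn begins. The robber wins if his location is never determined. The centroidal localization number $\zeta^*(G)$ is the minimum $k$ such that the Cop-player has a strategy that wins against every robber strategy. -}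

module Defs where

open import Data.Nat using (ℕ; zero; suc; _≤_; _<_; _<ᵇ_)
open import Data.Fin using (Fin)
open import Data.Fin.Properties using (_≟_)
open import Data.Bool using (Bool; true; false; _∨_; _∧_; if_then_else_)
open import Data.List using (List; []; _∷_; map; length; allFin)
open import Data.Bool.ListAction using (any)
open import Data.Maybe using (Maybe; just; nothing)
open import Data.Product using (Σ; _×_; _,_; proj₁; ∃)
open import Data.Sum using (_⊎_)
open import Relation.Nullary using (¬_)
open import Relation.Nullary.Decidable using (⌊_⌋)
open import Relation.Binary.PropositionalEquality using (_≡_)

record Graph (n : ℕ) : Set where
  field
    adj    : Fin n → Fin n → Bool
    sym    : ∀ u v → adj u v ≡ adj v u
    irrefl : ∀ v → adj v v ≡ false
open Graph public

module _ {n : ℕ} (G : Graph n) where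

  reach : ℕ → Fin n → Fin n → Bool
  reach zero    u v = ⌊ u ≟ v ⌋
  reach (suc m) u v = reach m u v ∨ any (λ w → adj G u w ∧ reach m w v) (allFin n)

  private
    search : (ℕ → Bool) → ℕ → ℕ → Maybe ℕ
    search f m zero       = nothing
    search f m (suc fuel) = if f m then just m else search f (suc m) fuel

  -- graph distance; nothing = ∞ (different components).
  -- In an n-vertex graph a shortest path has length < n.
  dist : Fin n → Fin n → Maybe ℕ
  dist u v = search (λ m → reach m u v) 0 n

data Cmp : Set where
  LT EQ GT : Cmp

cmpDist : Maybe ℕ → Maybe ℕ → Cmp
cmpDist nothing  nothing  = EQ
cmpDist nothing  (just _) = GT
cmpDist (just _) nothing  = LT
cmpDist (just a) (just b) = if a <ᵇ b then LT else (if b <ᵇ a then GT else EQ)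

-- The answer to a probe: for each probed vertex whether it is the robber's
-- vertex, and for each ordered pair of probed vertices the comparison of
-- their distances to the robber.
Answer : Set
Answer = List Bool × List (List Cmp)

module _ {n : ℕ} (G : Graph n) where

  answer : List (Fin n) → Fin n → Answer
  answer P r = map (λ v → ⌊ v ≟ r ⌋) P
             , map (λ u → map (λ v → cmpDist (dist G u r) (dist G v r)) P) P

  Probe : ℕ → Set
  Probe k = Σ (List (Fin n)) (λ P → length P ≤ k)

  -- A (deterministic) Cop strategy: the next probe is chosen as a function
  -- of all answers received so far (most recent first).
  CopStrategy : ℕ → Set
  CopStrategy k = List Answer → Probe k

  IsRobberWalk : (ℕ → Fin n) → Set
  IsRobberWalk r = ∀ t → r (suc t) ≡ r t ⊎ adj G (r t) (r (suc t)) ≡ true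

  -- answers received during turns 0 .. t-1
  history : ∀ {k} → CopStrategy k → (ℕ → Fin n) → ℕ → List Answer
  history σ r zero    = []
  history σ r (suc t) = answer (proj₁ (σ (history σ r t))) (r t) ∷ history σ r t

  Located : ∀ {k} → CopStrategy k → (ℕ → Fin n) → ℕ → Set
  Located σ r t = ∀ r' → IsRobberWalk r' →
                  history σ r' (suc t) ≡ history σ r (suc t) → r' t ≡ r t

  CopWins : ℕ → Set
  CopWins k = Σ (CopStrategy k) λ σ → ∀ r → IsRobberWalk r → ∃ λ t → Located σ r t

  ZetaStarIs : ℕ → Set
  ZetaStarIs k = (1 ≤ k) × CopWins k × (∀ j → 1 ≤ j → j < k → ¬ CopWins j)

AtMostOneEdge : ∀ {n} → Graph n → Set
AtMostOneEdge {n} G = ∀ (a b c d : Fin n) → adj G a b ≡ true → adj G c d ≡ true →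
                      (a ≡ c × b ≡ d) ⊎ (a ≡ d × b ≡ c)

module Submission where

-- A single probe {v} only tells the Cop whether the robber is at v
-- (answerMiss, answerHit); the rest of the answer is the tie of v with itself.
-- (⇒) Given two different edges {a,b} and {c,d}, at every turn there are
--     vertices x ∈ {a,b}, y ∈ {c,d}, x ≠ y, both off the probe (evade).
--     Robbers walking on x and on y are legal (edgeStep), always get the miss
--     answer and so identical histories, yet never meet: the Cop never
--     locates the first one (neverLocated).
-- (⇐) If all vertices outside {a,b} are isolated, the Cop probes 0, …, n-1,
--     then a (module Sweep).  A robber never caught cannot be on an isolated
--     vertex u (he would have stayed there and been caught at turn u,
--     staysIsolated) nor on a, so at turn n he is at b.

open import Defs hiding (sym)
open import Data.Nat using (ℕ; zero; suc; _≤_; _<_; _<ᵇ_; _≤′_; ≤′-reflexive; ≤′-step; z≤n; s≤s; _<?_)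
open import Data.Nat.Properties using (≤⇒≤′; <⇒≤; <⇒≱; <-irrefl; n<1+n; m<n⇒m<1+n; anyUpTo?)
open import Data.Fin using (Fin; zero; toℕ; fromℕ<)
open import Data.Fin.Properties using (_≟_; any?; toℕ<n; fromℕ<-toℕ)
open import Data.Bool using (true; false)
import Data.Bool.Properties as Bool
open import Data.List using (List; []; _∷_; map; length)
open import Data.List.Properties using (∷-injective)
open import Data.List.Membership.Propositional using (_∉_)
open import Data.List.Relation.Unary.Any using (here)
open import Data.Maybe using (just; nothing)
open import Data.Product using (Σ-syntax; ∃; _×_; _,_; proj₁; proj₂)
open import Data.Sum using (_⊎_; inj₁; inj₂)
open import Data.Empty using (⊥-elim)
open import Relation.Nullary using (¬_; yes; no; contradiction)
open import Relation.Nullary.Decidable using (_×-dec_; _⊎-dec_)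
open import Relation.Binary.Definitions using (DecidableEquality)
open import Relation.Binary.PropositionalEquality using (_≡_; _≢_; refl; sym; trans; cong; cong₂; subst)

<ᵇ-irrefl : ∀ a → (a <ᵇ a) ≡ false
<ᵇ-irrefl zero    = refl
<ᵇ-irrefl (suc a) = <ᵇ-irrefl a

cmpDist-refl : ∀ m → cmpDist m m ≡ EQ
cmpDist-refl nothing  = refl
cmpDist-refl (just a) rewrite <ᵇ-irrefl a = refl

missAnswer : ∀ {n} → List (Fin n) → Answer
missAnswer P = map (λ _ → false) P , map (λ _ → map (λ _ → EQ) P) P

Endpoint : ∀ {A : Set} → A → A → A → Set
Endpoint x a b = x ≡ a ⊎ x ≡ b

SamePair : ∀ {A : Set} → A → A → A → A → Set
SamePair a b c d = (a ≡ c × b ≡ d) ⊎ (a ≡ d × b ≡ c)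

module _ {n : ℕ} (G : Graph n) where

  probe : ∀ {k} → CopStrategy G k → List Answer → List (Fin n)
  probe σ h = proj₁ (σ h)

  answerMiss : ∀ P → length P ≤ 1 → ∀ {x} → x ∉ P → answer G P x ≡ missAnswer P
  answerMiss []           _         _   = refl
  answerMiss (v ∷ [])     _         {x} x∉P with v ≟ x
  ... | yes v≡x = contradiction (here (sym v≡x)) x∉P
  ... | no _    rewrite cmpDist-refl (dist G v x) = refl
  answerMiss (_ ∷ _ ∷ _)  (s≤s ())  _

  answerHit : ∀ v {x y} → answer G (v ∷ []) x ≡ answer G (v ∷ []) y → x ≡ v → y ≡ v
  answerHit v {x} {y} same x≡v with v ≟ x | v ≟ y | cong proj₁ same
  ... | _       | yes v≡y | _  = sym v≡y
  ... | yes _   | no _    | ()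
  ... | no v≢x  | no _    | _  = contradiction (sym x≡v) v≢x

  historyLength : ∀ {k} (σ : CopStrategy G k) r t → length (history G σ r t) ≡ t
  historyLength σ r zero    = refl
  historyLength σ r (suc t) = cong suc (historyLength σ r t)

  historyPrefix : ∀ {k} (σ : CopStrategy G k) {r r' t m} → t ≤′ m →
                  history G σ r m ≡ history G σ r' m → history G σ r t ≡ history G σ r' t
  historyPrefix σ (≤′-reflexive refl) same = same
  historyPrefix σ (≤′-step t≤m)       same = historyPrefix σ t≤m (proj₂ (∷-injective same))

  lastAnswer : ∀ {k} (σ : CopStrategy G k) {r r'} t →
               history G σ r (suc t) ≡ history G σ r' (suc t) →
               answer G (probe σ (history G σ r t)) (r t) ≡ answer G (probe σ (history G σ r t)) (r' t)
  lastAnswer σ {r} {r'} t same with ∷-injective same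
  ... | sameAnswer , sameBefore =
    trans sameAnswer (cong (λ h → answer G (probe σ h) (r' t)) (sym sameBefore))

  neverLocated : ∀ {k} (σ : CopStrategy G k) {r r'} → IsRobberWalk G r' →
                 (∀ t → history G σ r' t ≡ history G σ r t) → (∀ t → r' t ≢ r t) →
                 ∀ t → ¬ Located G σ r t
  neverLocated σ walk' same apart t located = apart t (located _ walk' (same (suc t)))

  edgeStep : ∀ {a b x y : Fin n} → adj G a b ≡ true → Endpoint x a b → Endpoint y a b →
             y ≡ x ⊎ adj G x y ≡ true
  edgeStep     ab (inj₁ refl) (inj₁ refl) = inj₁ refl
  edgeStep     ab (inj₁ refl) (inj₂ refl) = inj₂ ab
  edgeStep {a} {b} ab (inj₂ refl) (inj₁ refl) = inj₂ (trans (Graph.sym G b a) ab)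
  edgeStep     ab (inj₂ refl) (inj₂ refl) = inj₁ refl

  edgeEnds≢ : ∀ {a b : Fin n} → adj G a b ≡ true → a ≢ b
  edgeEnds≢ {a} ab refl = contradiction (trans (sym ab) (irrefl G a)) λ ()

  Isolated : Fin n → Set
  Isolated u = ∀ w → adj G w u ≡ false

  staysIsolated : ∀ {r} → IsRobberWalk G r → ∀ {u} → Isolated u →
                  ∀ {t m} → t ≤′ m → r m ≡ u → r t ≡ u
  staysIsolated walk iso (≤′-reflexive refl) rm≡u = rm≡u
  staysIsolated {r} walk {u} iso (≤′-step {m} t≤m) r[1+m]≡u =
    staysIsolated walk iso t≤m (cameFrom (walk m))
    where
    cameFrom : r (suc m) ≡ r m ⊎ adj G (r m) (r (suc m)) ≡ true → r m ≡ u
    cameFrom (inj₁ stayed) = trans (sym stayed) r[1+m]≡u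
    cameFrom (inj₂ moved)  =
      contradiction (trans (sym (subst (λ z → adj G (r m) z ≡ true) r[1+m]≡u moved)) (iso (r m))) λ ()

module TwoPairs {A : Set} (_≟ᴬ_ : DecidableEquality A) where

  avoidTwo : ∀ {c d : A} → c ≢ d → ∀ u w →
             (Σ[ y ∈ A ] Endpoint y c d × y ≢ u × y ≢ w) ⊎ SamePair c d u w
  avoidTwo {c} {d} c≢d u w with c ≟ᴬ u | c ≟ᴬ w | d ≟ᴬ u | d ≟ᴬ w
  ... | no c≢u  | no c≢w  | _       | _       = inj₁ (c , inj₁ refl , c≢u , c≢w)
  ... | _       | _       | no d≢u  | no d≢w  = inj₁ (d , inj₂ refl , d≢u , d≢w)
  ... | yes c≡u | _       | yes d≡u | _       = contradiction (trans c≡u (sym d≡u)) c≢d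
  ... | _       | yes c≡w | _       | yes d≡w = contradiction (trans c≡w (sym d≡w)) c≢d
  ... | yes c≡u | _       | _       | yes d≡w = inj₂ (inj₁ (c≡u , d≡w))
  ... | _       | yes c≡w | yes d≡u | _       = inj₂ (inj₂ (c≡w , d≡u))

  samePair-trans : ∀ {a b c d u w : A} → SamePair a b u w → SamePair c d u w → SamePair a b c d
  samePair-trans (inj₁ (refl , refl)) (inj₁ (refl , refl)) = inj₁ (refl , refl)
  samePair-trans (inj₁ (refl , refl)) (inj₂ (refl , refl)) = inj₂ (refl , refl)
  samePair-trans (inj₂ (refl , refl)) (inj₁ (refl , refl)) = inj₂ (refl , refl)
  samePair-trans (inj₂ (refl , refl)) (inj₂ (refl , refl)) = inj₁ (refl , refl)

  secondEndpoint : ∀ {c d u w : A} → SamePair c d u w → Endpoint w c d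
  secondEndpoint (inj₁ (_ , d≡w)) = inj₂ (sym d≡w)
  secondEndpoint (inj₂ (c≡w , _)) = inj₁ (sym c≡w)

  record Evaders (a b c d : A) (P : List A) : Set where
    field
      x     : A
      y     : A
      x-end : Endpoint x a b
      y-end : Endpoint y c d
      x∉P   : x ∉ P
      y∉P   : y ∉ P
      x≢y   : x ≢ y

  ≢⇒∉ : ∀ {x v : A} → x ≢ v → x ∉ v ∷ []
  ≢⇒∉ x≢v (here x≡v) = x≢v x≡v

  evadeVertex : ∀ {a b c d : A} → a ≢ b → c ≢ d → ¬ SamePair a b c d → ∀ v → Evaders a b c d (v ∷ [])
  evadeVertex a≢b c≢d distinct v with avoidTwo a≢b v v
  ... | inj₂ (inj₁ (a≡v , b≡v)) = contradiction (trans a≡v (sym b≡v)) a≢b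
  ... | inj₂ (inj₂ (a≡v , b≡v)) = contradiction (trans a≡v (sym b≡v)) a≢b
  ... | inj₁ (x , x-end , x≢v , _) with avoidTwo c≢d v x
  ...   | inj₁ (y , y-end , y≢v , y≢x) =
          record { x = x ; y = y ; x-end = x-end ; y-end = y-end
                 ; x∉P = ≢⇒∉ x≢v ; y∉P = ≢⇒∉ y≢v ; x≢y = λ x≡y → y≢x (sym x≡y) }
  ...   | inj₂ cd≡vx with avoidTwo a≢b v x
  ...     | inj₁ (x' , x'-end , x'≢v , x'≢x) =
            record { x = x' ; y = x ; x-end = x'-end ; y-end = secondEndpoint cd≡vx
                   ; x∉P = ≢⇒∉ x'≢v ; y∉P = ≢⇒∉ x≢v ; x≢y = x'≢x }
  ...     | inj₂ ab≡vx = contradiction (samePair-trans ab≡vx cd≡vx) distinct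

  evade : ∀ {a b c d : A} → a ≢ b → c ≢ d → ¬ SamePair a b c d →
          ∀ P → length P ≤ 1 → Evaders a b c d P
  evade {a} a≢b c≢d distinct [] _ =
    record { x = x ; y = y ; x-end = x-end ; y-end = y-end ; x∉P = λ () ; y∉P = λ () ; x≢y = x≢y }
    where open Evaders (evadeVertex a≢b c≢d distinct a)
  evade a≢b c≢d distinct (v ∷ [])    _        = evadeVertex a≢b c≢d distinct v
  evade a≢b c≢d distinct (_ ∷ _ ∷ _) (s≤s ())

module OneCopForcesOneEdge {n : ℕ} (G : Graph n) where
  open TwoPairs (_≟_ {n})

  silentHistory : CopStrategy G 1 → ℕ → List Answer
  silentHistory σ zero    = []
  silentHistory σ (suc t) = missAnswer (probe G σ (silentHistory σ t)) ∷ silentHistory σ t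

  historySilent : (σ : CopStrategy G 1) (r : ℕ → Fin n) →
                  (∀ t → r t ∉ probe G σ (silentHistory σ t)) →
                  ∀ t → history G σ r t ≡ silentHistory σ t
  historySilent σ r avoids zero    = refl
  historySilent σ r avoids (suc t) = cong₂ _∷_ lastMissed before
    where
    before : history G σ r t ≡ silentHistory σ t
    before = historySilent σ r avoids t
    lastMissed : answer G (probe G σ (history G σ r t)) (r t) ≡ missAnswer (probe G σ (silentHistory σ t))
    lastMissed = trans (cong (λ h → answer G (probe G σ h) (r t)) before)
                       (answerMiss G _ (proj₂ (σ (silentHistory σ t))) (avoids t))

  twoEdgesDefeatOneCop : ∀ {a b c d : Fin n} → adj G a b ≡ true → adj G c d ≡ true →
                         ¬ SamePair a b c d → ¬ CopWins G 1
  twoEdgesDefeatOneCop {a} {b} {c} {d} ab cd distinct (σ , wins) =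
    neverLocated G σ walk₂ sameHistory apart (proj₁ located) (proj₂ located)
    where
    open Evaders
    evaders : ∀ t → Evaders a b c d (probe G σ (silentHistory σ t))
    evaders t = evade (edgeEnds≢ G ab) (edgeEnds≢ G cd) distinct _ (proj₂ (σ (silentHistory σ t)))
    r₁ r₂ : ℕ → Fin n
    r₁ t = x (evaders t)
    r₂ t = y (evaders t)
    walk₁ : IsRobberWalk G r₁
    walk₁ t = edgeStep G ab (x-end (evaders t)) (x-end (evaders (suc t)))
    walk₂ : IsRobberWalk G r₂
    walk₂ t = edgeStep G cd (y-end (evaders t)) (y-end (evaders (suc t)))
    located : ∃ λ t → Located G σ r₁ t
    located = wins r₁ walk₁
    sameHistory : ∀ t → history G σ r₂ t ≡ history G σ r₁ t
    sameHistory t = trans (historySilent σ r₂ (λ t → y∉P (evaders t)) t)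
                          (sym (historySilent σ r₁ (λ t → x∉P (evaders t)) t))
    apart : ∀ t → r₂ t ≢ r₁ t
    apart t y≡x = x≢y (evaders t) (sym y≡x)

  atMostOneEdge : CopWins G 1 → AtMostOneEdge G
  atMostOneEdge wins a b c d ab cd with (a ≟ c ×-dec b ≟ d) ⊎-dec (a ≟ d ×-dec b ≟ c)
  ... | yes same     = same
  ... | no distinct  = ⊥-elim (twoEdgesDefeatOneCop ab cd distinct wins)

module Sweep {n : ℕ} (G : Graph n) (a b : Fin n)
             (outsideIsolated : ∀ u → u ≢ a → u ≢ b → Isolated G u) where

  sweep : ℕ → Fin n
  sweep t with t <? n
  ... | yes t<n = fromℕ< t<n
  ... | no _    = a

  sweep-toℕ : ∀ u → sweep (toℕ u) ≡ u
  sweep-toℕ u with toℕ u <? n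
  ... | yes u<n = fromℕ<-toℕ u u<n
  ... | no u≮n  = contradiction (toℕ<n u) u≮n

  sweep-n : sweep n ≡ a
  sweep-n with n <? n
  ... | yes n<n = contradiction n<n (<-irrefl refl)
  ... | no _    = refl

  σ : CopStrategy G 1
  σ h = sweep (length h) ∷ [] , s≤s z≤n

  caughtShared : ∀ {r r'} t → history G σ r (suc t) ≡ history G σ r' (suc t) →
                 r t ≡ sweep t → r' t ≡ sweep t
  caughtShared {r} {r'} t same = answerHit G (sweep t) probedSweep
    where
    probedSweep : answer G (sweep t ∷ []) (r t) ≡ answer G (sweep t ∷ []) (r' t)
    probedSweep = subst (λ s → answer G (sweep s ∷ []) (r t) ≡ answer G (sweep s ∷ []) (r' t))
                        (historyLength G σ r t) (lastAnswer G σ t same)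

  uncaughtEndsAtB : ∀ {r} → IsRobberWalk G r → (∀ t → t < suc n → r t ≢ sweep t) → r n ≡ b
  uncaughtEndsAtB {r} walk uncaught with r n ≟ a | r n ≟ b
  ... | yes rn≡a | _        = contradiction (trans rn≡a (sym sweep-n)) (uncaught n (n<1+n n))
  ... | no _     | yes rn≡b = rn≡b
  ... | no rn≢a  | no rn≢b  =
    contradiction (trans alwaysThere (sym (sweep-toℕ (r n)))) (uncaught (toℕ (r n)) (m<n⇒m<1+n (toℕ<n (r n))))
    where
    alwaysThere : r (toℕ (r n)) ≡ r n
    alwaysThere = staysIsolated G walk (outsideIsolated (r n) rn≢a rn≢b) (≤⇒≤′ (<⇒≤ (toℕ<n (r n)))) refl

  -- A caught robber is located at his catch; one never caught, at turn n.
  sweepWins : CopWins G 1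
  sweepWins = σ , locate
    where
    locate : ∀ r → IsRobberWalk G r → ∃ λ t → Located G σ r t
    locate r walk with anyUpTo? (λ t → r t ≟ sweep t) (suc n)
    ... | yes (t , _ , caught) = t , λ _ _ same → trans (caughtShared t (sym same) caught) (sym caught)
    ... | no neverCaught       = n , λ _ walk' same →
            trans (uncaughtEndsAtB walk' (uncaught' same)) (sym (uncaughtEndsAtB walk uncaught))
      where
      uncaught : ∀ t → t < suc n → r t ≢ sweep t
      uncaught t t<1+n caught = neverCaught (t , t<1+n , caught)
      uncaught' : ∀ {r'} → history G σ r' (suc n) ≡ history G σ r (suc n) →
                  ∀ t → t < suc n → r' t ≢ sweep t
      uncaught' same t t<1+n caught' =
        uncaught t t<1+n (caughtShared t (historyPrefix G σ (≤⇒≤′ t<1+n) same) caught')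

edgeCover : ∀ {n} (G : Graph (suc n)) → AtMostOneEdge G →
            Σ[ a ∈ Fin (suc n) ] Σ[ b ∈ Fin (suc n) ] (∀ u → u ≢ a → u ≢ b → Isolated G u)
edgeCover G oneEdge with any? (λ c → any? (λ d → adj G c d Bool.≟ true))
... | yes (c , d , cd) = c , d , isolated
  where
  isolated : ∀ u → u ≢ c → u ≢ d → Isolated G u
  isolated u u≢c u≢d w with adj G w u in wu
  ... | false = refl
  ... | true with oneEdge w u c d wu cd
  ...   | inj₁ (_ , u≡d) = contradiction u≡d u≢d
  ...   | inj₂ (_ , u≡c) = contradiction u≡c u≢c
... | no noEdge = zero , zero , isolated
  where
  isolated : ∀ u → u ≢ zero → u ≢ zero → Isolated G u
  isolated u _ _ w with adj G w u in wu
  ... | false = refl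
  ... | true  = contradiction (w , u , wu) noEdge

oneCopSuffices : ∀ n (G : Graph n) → AtMostOneEdge G → CopWins G 1
oneCopSuffices zero    G _       = (λ _ → [] , z≤n) , noRobber
  where
  noRobber : ∀ r → IsRobberWalk G r → ∃ λ t → Located G (λ _ → [] , z≤n) r t
  noRobber r _ with r 0
  ... | ()
oneCopSuffices (suc n) G oneEdge with edgeCover G oneEdge
... | a , b , outsideIsolated = Sweep.sweepWins G a b outsideIsolated

mainTheorem1 : (n : ℕ) (G : Graph n) →
    (ZetaStarIs G 1 → AtMostOneEdge G) × (AtMostOneEdge G → ZetaStarIs G 1)
mainTheorem1 n G =
  (λ (_ , wins , _) → OneCopForcesOneEdge.atMostOneEdge G wins) ,
  (λ oneEdge → s≤s z≤n , oneCopSuffices n G oneEdge , λ j 1≤j j<1 _ → <⇒≱ j<1 1≤j)
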